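{- Let $G=(V,E)$ be a finite, simple, connected graph that is claw-free and AT-free, let $s\in V$ be admissible in $G$, let $k$ be the eccentricity of $s$, and let $t$ be a vertex with $\mathrm{dist}_G(s,t)=k$. Then for every $i\in\{0,2,3,\ldots,k\}$ the distance layer $L_G^i(s)$ is a clique, and $s$ and $t$ form a dominating pair of $G$.
   Context: $L_G^i(s)=\{v\in V:\mathrm{dist}_G(s,v)=i\}$. A graph is claw-free if it has no induced $K_{1,3}$. An asteroidal triple is an independent set of three vertices such that for any two of them there is a path between them containing no neighbour of the third; $G$ is AT-free if it has none. A path $P$ avoids a vertex $v$ if $v$ has no neighbour on $P$. The domination betweenness $\mathcal{B}_D(G)$ is the set of triples $(x,y,z)$ of distinct vertices such that there is a chordless $x$-$y$-path avoiding $z$ and a chordless $y$-$z$-path avoiding $x$. A vertex $y$ is admissible if there are no $x,z$ with $(x,y,z)\in\mathcal{B}_D(G)$. Two vertices $s,t$ form a dominating pair if the vertex set of every $s$-$t$-path is a dominating set of $G$. -}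

module Defs where

open import Data.Nat using (ℕ; zero; suc; _≤_)
open import Data.Fin using (Fin)
open import Data.List using (List; []; _∷_; drop)
open import Data.List.Relation.Unary.All using (All)
open import Data.List.Relation.Unary.Any using (Any)
open import Data.List.Membership.Propositional using (_∈_)
open import Data.List.Relation.Unary.Unique.Propositional using (Unique)
open import Data.Product using (Σ; _×_; ∃; ∃-syntax)
open import Data.Sum using (_⊎_)
open import Data.Unit using (⊤)
open import Relation.Nullary using (¬_; Dec)
open import Relation.Binary.PropositionalEquality using (_≡_; _≢_)

record Graph (n : ℕ) : Set₁ where
  field
    Adj     : Fin n → Fin n → Set
    adj-dec : ∀ u v → Dec (Adj u v)
    sym     : ∀ {u v} → Adj u v → Adj v u
    irrefl  : ∀ {u} → ¬ Adj u u

module _ {n : ℕ} (G : Graph n) where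
  open Graph G

  V : Set
  V = Fin n

  data Walk : V → V → Set where
    [_]    : ∀ v → Walk v v
    _∷⟨_⟩_ : ∀ u {v w} → Adj u v → Walk v w → Walk u w

  len : ∀ {u v} → Walk u v → ℕ
  len [ _ ]          = zero
  len (_ ∷⟨ _ ⟩ p)   = suc (len p)

  verts : ∀ {u v} → Walk u v → List V
  verts [ v ]        = v ∷ []
  verts (u ∷⟨ _ ⟩ p) = u ∷ verts p

  IsPath : ∀ {u v} → Walk u v → Set
  IsPath p = Unique (verts p)

  NoChords : List V → Set
  NoChords []       = ⊤
  NoChords (x ∷ xs) = All (λ y → ¬ Adj x y) (drop 1 xs) × NoChords xs

  IsChordlessPath : ∀ {u v} → Walk u v → Set
  IsChordlessPath p = IsPath p × NoChords (verts p)

  Avoids : ∀ {u v} → Walk u v → V → Set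
  Avoids p z = All (λ w → ¬ Adj z w) (verts p)

  Dist : V → V → ℕ → Set
  Dist u v d = (Σ (Walk u v) λ p → len p ≡ d) × (∀ (p : Walk u v) → d ≤ len p)

  Connected : Set
  Connected = ∀ u v → Walk u v

  ClawFree : Set
  ClawFree = ∀ c a b d → Adj c a → Adj c b → Adj c d →
             a ≢ b → a ≢ d → b ≢ d →
             ¬ (¬ Adj a b × ¬ Adj a d × ¬ Adj b d)

  Independent3 : V → V → V → Set
  Independent3 x y z = x ≢ y × x ≢ z × y ≢ z × ¬ Adj x y × ¬ Adj x z × ¬ Adj y z

  PathAvoiding : V → V → V → Set
  PathAvoiding a b c = Σ (Walk a b) λ p → IsPath p × Avoids p c

  AsteroidalTriple : V → V → V → Set
  AsteroidalTriple x y z = Independent3 x y z ×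
    PathAvoiding x y z × PathAvoiding x z y × PathAvoiding y z x

  ATFree : Set
  ATFree = ∀ x y z → ¬ AsteroidalTriple x y z

  DomBetween : V → V → V → Set
  DomBetween x y z = x ≢ y × x ≢ z × y ≢ z ×
    (Σ (Walk x y) λ p → IsChordlessPath p × Avoids p z) ×
    (Σ (Walk y z) λ q → IsChordlessPath q × Avoids q x)

  Admissible : V → Set
  Admissible y = ∀ x z → ¬ DomBetween x y z

  IsEccentricity : V → ℕ → Set
  IsEccentricity s k = (∀ v d → Dist s v d → d ≤ k) × (∃[ v ] Dist s v k)

  LayerClique : V → ℕ → Set
  LayerClique s i = ∀ u v → Dist s u i → Dist s v i → u ≢ v → Adj u v

  Dominating : List V → Set
  Dominating D = ∀ w → w ∈ D ⊎ Any (Adj w) D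

  DominatingPair : V → V → Set
  DominatingPair s t = ∀ (p : Walk s t) → IsPath p → Dominating (verts p)

module Submission where

-- Proof idea.  Write d(x) for dist(s,x).  A shortest walk is a chordless
-- path, and d changes by at most one along an edge.
--
--  * Layers are cliques.  Let u ≠ v be non-adjacent with d(u) = d(v) = i ≥ 2.
--    A vertex x of a shortest s-u-path that is adjacent to v has
--    d(x) ≥ i - 1, so x is the predecessor of u on the path; with a
--    neighbour y of x in layer i - 2 this yields a claw centred at x with
--    leaves u, v, y.  Hence a shortest s-u-path avoids v and a shortest
--    s-v-path avoids u, i.e. (u, s, v) ∈ B_D(G), contradicting the
--    admissibility of s.  Layer 0 is {s}.
--  * Dominating pair.  Let P be an s-t-path and w a vertex.  If d(w) = 1,
--    w is adjacent to s ∈ P.  Otherwise d(w) ≤ k = d(t), so P meets the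
--    layer of w (a discrete intermediate value theorem), a clique.

open import Defs
open import Data.Nat using (ℕ; zero; suc; _≤_; _+_; z≤n; s≤s)
open import Data.Nat.Properties
  using (≤-refl; ≤-reflexive; ≤-trans; ≤-antisym; ≤-pred; ≤∧≢⇒<; ≮⇒≥; 1+n≰n;
         m≤n+m; m+n≤o⇒n≤o; +-comm; +-cancelˡ-≤; suc-injective; anyUpTo?;
         module ≤-Reasoning)
  renaming (_≟_ to _≟ℕ_)
open import Data.Fin using (_≟_)
open import Data.Fin.Properties using (any?)
open import Data.List.Relation.Unary.All as All using ([]; _∷_)
open import Data.List.Relation.Unary.Any using (here; there)
open import Data.List.Relation.Unary.AllPairs using ([]; _∷_)
open import Data.List.Membership.Propositional using (_∈_; lose)
open import Data.Product using (Σ; ∃-syntax; _×_; _,_; proj₁; proj₂)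
open import Data.Sum using (_⊎_; inj₁; inj₂)
open import Data.Unit using (tt)
open import Data.Empty using (⊥; ⊥-elim)
open import Function using (_∘_)
open import Relation.Nullary using (¬_; Dec; yes; no)
open import Relation.Nullary.Decidable using (_×-dec_)
open import Relation.Binary.PropositionalEquality
  using (_≡_; _≢_; refl; sym; trans; cong; subst; subst₂)

module _ {n : ℕ} (G : Graph n) where
  open Graph G renaming (sym to adj-sym)

  snoc : ∀ {a b c} → Walk G a b → Adj b c → Walk G a c
  snoc [ a ]          e′ = a ∷⟨ e′ ⟩ [ _ ]
  snoc (a ∷⟨ e ⟩ p) e′ = a ∷⟨ e ⟩ snoc p e′

  len-snoc : ∀ {a b c} (p : Walk G a b) (e : Adj b c) →
             len G (snoc p e) ≡ suc (len G p)
  len-snoc [ a ]         e′ = refl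
  len-snoc (a ∷⟨ e ⟩ p) e′ = cong suc (len-snoc p e′)

  ∈-snoc : ∀ {a b c x} (p : Walk G a b) (e : Adj b c) →
           x ∈ verts G (snoc p e) → x ∈ verts G p ⊎ x ≡ c
  ∈-snoc [ a ]         e′ (here x≡a)         = inj₁ (here x≡a)
  ∈-snoc [ a ]         e′ (there (here x≡c)) = inj₂ x≡c
  ∈-snoc (a ∷⟨ e ⟩ p) e′ (here x≡a)         = inj₁ (here x≡a)
  ∈-snoc (a ∷⟨ e ⟩ p) e′ (there x∈)  with ∈-snoc p e′ x∈
  ... | inj₁ x∈p = inj₁ (there x∈p)
  ... | inj₂ x≡c = inj₂ x≡c

  reverse : ∀ {a b} → Walk G a b → Walk G b a
  reverse [ a ]          = [ a ]
  reverse (a ∷⟨ e ⟩ p) = snoc (reverse p) (adj-sym e)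

  len-reverse : ∀ {a b} (p : Walk G a b) → len G (reverse p) ≡ len G p
  len-reverse [ a ]         = refl
  len-reverse (a ∷⟨ e ⟩ p) =
    trans (len-snoc (reverse p) (adj-sym e)) (cong suc (len-reverse p))

  ∈-reverse : ∀ {a b x} (p : Walk G a b) → x ∈ verts G (reverse p) → x ∈ verts G p
  ∈-reverse [ a ]         x∈ = x∈
  ∈-reverse (a ∷⟨ e ⟩ p) x∈ with ∈-snoc (reverse p) (adj-sym e) x∈
  ... | inj₁ x∈p = there (∈-reverse p x∈p)
  ... | inj₂ x≡a = here x≡a

  avoids-reverse : ∀ {a b z} (p : Walk G a b) → Avoids G p z → Avoids G (reverse p) z
  avoids-reverse p avoids = All.tabulate (All.lookup avoids ∘ ∈-reverse p)

  start-∈ : ∀ {a b} (p : Walk G a b) → a ∈ verts G p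
  start-∈ [ a ]         = here refl
  start-∈ (a ∷⟨ e ⟩ p) = here refl

  split : ∀ {a b x} (p : Walk G a b) → x ∈ verts G p →
          Σ (Walk G a x) λ pre → Σ (Walk G x b) λ suf → len G pre + len G suf ≡ len G p
  split [ a ]         (here refl) = [ a ] , [ a ] , refl
  split (a ∷⟨ e ⟩ p) (here refl) = [ a ] , (a ∷⟨ e ⟩ p) , refl
  split (a ∷⟨ e ⟩ p) (there x∈p) with split p x∈p
  ... | pre , suf , eq = (a ∷⟨ e ⟩ pre) , suf , cong suc eq

  suffix : ∀ {a b x} (p : Walk G a b) → x ∈ verts G p →
           Σ (Walk G x b) λ suf → len G suf ≤ len G p
  suffix p x∈p with split p x∈p
  ... | pre , suf , eq = suf , subst (len G suf ≤_) eq (m≤n+m (len G suf) (len G pre))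

  last-edge : ∀ {a x j} (p : Walk G a x) → len G p ≡ suc j →
              ∃[ y ] Σ (Walk G a y) (λ q → len G q ≡ j) × Adj y x
  last-edge (a ∷⟨ e ⟩ [ _ ])          refl = a , ([ a ] , refl) , e
  last-edge (a ∷⟨ e ⟩ p@(_ ∷⟨ _ ⟩ _)) refl with last-edge p refl
  ... | y , (q , q≡) , y~x = y , ((a ∷⟨ e ⟩ q) , cong suc q≡) , y~x

  Shortest : ∀ {a b} → Walk G a b → Set
  Shortest {a} {b} p = ∀ (q : Walk G a b) → len G p ≤ len G q

  dist⇒shortest : ∀ {a b d} → Dist G a b d →
                  Σ (Walk G a b) λ p → len G p ≡ d × Shortest p
  dist⇒shortest ((p , refl) , minimal) = p , refl , minimal

  shortest-tail : ∀ {a v b} (e : Adj a v) (p : Walk G v b) →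
                  Shortest (a ∷⟨ e ⟩ p) → Shortest p
  shortest-tail e p shortest q = ≤-pred (shortest (_ ∷⟨ e ⟩ q))

  shortest-reverse : ∀ {a b} (p : Walk G a b) → Shortest p → Shortest (reverse p)
  shortest-reverse p shortest q =
    subst₂ _≤_ (sym (len-reverse p)) (len-reverse q) (shortest (reverse q))

  -- A shortest walk is a chordless path: a repeated vertex or a chord
  -- would give a shortcut.
  shortest⇒path : ∀ {a b} (p : Walk G a b) → Shortest p → IsPath G p
  shortest⇒path [ a ]         _        = [] ∷ []
  shortest⇒path (a ∷⟨ e ⟩ p) shortest =
    All.tabulate no-return ∷ shortest⇒path p (shortest-tail e p shortest)
    where
    no-return : ∀ {y} → y ∈ verts G p → a ≢ y
    no-return y∈p refl with suffix p y∈p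
    ... | suf , suf≤p = 1+n≰n (≤-trans (shortest suf) suf≤p)

  shortest⇒noChords : ∀ {a b} (p : Walk G a b) → Shortest p → NoChords G (verts G p)
  shortest⇒noChords [ a ]                         _        = [] , tt
  shortest⇒noChords (a ∷⟨ e ⟩ [ v ])              shortest = [] , ([] , tt)
  shortest⇒noChords (a ∷⟨ e ⟩ p@(v ∷⟨ e′ ⟩ r)) shortest =
    All.tabulate no-chord , shortest⇒noChords p (shortest-tail e p shortest)
    where
    no-chord : ∀ {y} → y ∈ verts G r → ¬ Adj a y
    no-chord y∈r a~y with suffix r y∈r
    ... | suf , suf≤r = 1+n≰n (≤-trans (≤-pred (shortest (a ∷⟨ a~y ⟩ suf))) suf≤r)

  shortest⇒chordless : ∀ {a b} (p : Walk G a b) → Shortest p → IsChordlessPath G p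
  shortest⇒chordless p shortest = shortest⇒path p shortest , shortest⇒noChords p shortest

  walk-of-length? : ∀ m a b → Dec (Σ (Walk G a b) λ p → len G p ≡ m)
  walk-of-length? zero a b with a ≟ b
  ... | yes refl = yes ([ a ] , refl)
  ... | no a≢b   = no λ { ([ _ ] , refl) → a≢b refl ; ((_ ∷⟨ _ ⟩ _) , ()) }
  walk-of-length? (suc m) a b with any? (λ v → adj-dec a v ×-dec walk-of-length? m v b)
  ... | yes (v , e , p , p≡m) = yes ((a ∷⟨ e ⟩ p) , cong suc p≡m)
  ... | no none = no λ { ([ _ ] , ())
                       ; ((_ ∷⟨ e ⟩ p) , p≡) → none (_ , e , p , suc-injective p≡) }

  -- Vertices joined by a walk have a distance: shorten the walk while a
  -- shorter one exists.
  dist-exists : ∀ {a b} → Walk G a b → ∃[ d ] Dist G a b d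
  dist-exists {a} {b} p = shorten (len G p) p ≤-refl
    where
    shorten : ∀ bound (p : Walk G a b) → len G p ≤ bound → ∃[ d ] Dist G a b d
    shorten zero p p≤0 = len G p , (p , refl) , λ q → ≤-trans p≤0 z≤n
    shorten (suc bound) p p≤bound
      with anyUpTo? (λ m → walk-of-length? m a b) (len G p)
    ... | yes (_ , q<p , q , refl) = shorten bound q (≤-pred (≤-trans q<p p≤bound))
    ... | no none = len G p , (p , refl) ,
                    λ q → ≮⇒≥ λ q<p → none (len G q , q<p , q , refl)

  dist-unique : ∀ {a b d d′} → Dist G a b d → Dist G a b d′ → d ≡ d′
  dist-unique ((p , refl) , minimal) ((p′ , refl) , minimal′) =
    ≤-antisym (minimal p′) (minimal′ p)

  dist-zero : ∀ {s x} → Dist G s x 0 → x ≡ s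
  dist-zero (([ _ ] , refl) , _) = refl

  dist-positive⇒≢ : ∀ {s x j} → Dist G s x (suc j) → x ≢ s
  dist-positive⇒≢ (_ , minimal) refl with minimal [ _ ]
  ... | ()

  dist-step : ∀ {s a b da db} → Dist G s a da → Adj a b → Dist G s b db → db ≤ suc da
  dist-step ((p , refl) , _) e (_ , minimal) = subst (_ ≤_) (len-snoc p e) (minimal (snoc p e))

  dist-predecessor : ∀ {s x j} → Dist G s x (suc j) → ∃[ y ] Adj y x × Dist G s y j
  dist-predecessor ((p , p≡) , minimal) with last-edge p p≡
  ... | y , (q , refl) , y~x =
    y , y~x , (q , refl) ,
    λ q′ → ≤-pred (subst (_ ≤_) (len-snoc q′ y~x) (minimal (snoc q′ y~x)))

  -- Discrete intermediate value theorem: a vertex function growing by at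
  -- most one along each edge takes every intermediate value on a walk.
  crossing : (f : V G → ℕ) → (∀ {a b} → Adj a b → f b ≤ suc (f a)) →
             ∀ {j a b} (p : Walk G a b) → f a ≤ j → j ≤ f b →
             ∃[ x ] x ∈ verts G p × f x ≡ j
  crossing f step [ a ] fa≤j j≤fa = a , here refl , ≤-antisym fa≤j j≤fa
  crossing f step {j} (a ∷⟨ e ⟩ p) fa≤j j≤fb with f a ≟ℕ j
  ... | yes fa≡j = a , here refl , fa≡j
  ... | no fa≢j with crossing f step p (≤-trans (step e) (≤∧≢⇒< fa≤j fa≢j)) j≤fb
  ...   | x , x∈p , fx≡j = x , there x∈p , fx≡j

  two-layers-apart : ∀ {s y u j} → Dist G s y j → Dist G s u (suc (suc j)) →
                     u ≢ y × ¬ Adj u y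
  two-layers-apart dy du =
    (λ { refl → 1+n≰n (m+n≤o⇒n≤o 1 (≤-reflexive (sym (dist-unique dy du)))) }) ,
    (λ u~y → 1+n≰n (dist-step dy (adj-sym u~y) du))

  upper-neighbours-adjacent :
    ClawFree G → ∀ {s x y u v j} → Dist G s y j →
    Dist G s u (suc (suc j)) → Dist G s v (suc (suc j)) →
    Adj x y → Adj x u → Adj x v → u ≢ v → Adj u v
  upper-neighbours-adjacent claw-free {x = x} {y} {u} {v} dy du dv x~y x~u x~v u≢v
    with adj-dec u v
  ... | yes u~v = u~v
  ... | no u≁v with two-layers-apart dy du | two-layers-apart dy dv
  ...   | u≢y , u≁y | v≢y , v≁y =
    ⊥-elim (claw-free x u v y x~u x~v x~y u≢v u≢y v≢y (u≁v , u≁y , v≁y))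

  shortest-path-avoids :
    ClawFree G → ∀ {s u v i} → i ≢ 1 → Dist G s u i → Dist G s v i →
    u ≢ v → ¬ Adj u v → (p : Walk G s u) → len G p ≡ i → Avoids G p v
  shortest-path-avoids claw-free {s} {u} {v} {i} i≢1 du dv u≢v u≁v p p≡i =
    All.tabulate λ x∈p v~x → on-split (split p x∈p) v~x
    where
    open ≤-Reasoning

    -- A neighbour x of v on p lies in layer ≥ i - 1, so x is the last or
    -- second-to-last vertex of p; the former contradicts u ≁ v, the latter
    -- gives a claw at x with leaves u, v and a neighbour of x in layer i - 2.
    near-end : ∀ {x} (pre : Walk G s x) (suf : Walk G x u) → len G pre + len G suf ≡ i →
               ∀ d → Dist G s x d → ¬ Adj v x
    near-end pre [ _ ] _ _ _ v~x = u≁v (adj-sym v~x)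
    near-end pre suf@(_ ∷⟨ _ ⟩ (_ ∷⟨ _ ⟩ _)) pre+suf≡i d dx v~x
      with +-cancelˡ-≤ (len G pre) _ 1 (begin
             len G pre + len G suf ≡⟨ pre+suf≡i ⟩
             i                     ≤⟨ dist-step dx (adj-sym v~x) dv ⟩
             suc d                 ≤⟨ s≤s (proj₂ dx pre) ⟩
             suc (len G pre)       ≡⟨ +-comm 1 (len G pre) ⟩
             len G pre + 1         ∎)
    ... | s≤s ()
    near-end pre (_ ∷⟨ _ ⟩ [ _ ]) pre+1≡i zero dx v~x =
      i≢1 (≤-antisym (dist-step dx (adj-sym v~x) dv)
                     (subst (1 ≤_) pre+1≡i (m≤n+m 1 (len G pre))))
    near-end pre (_ ∷⟨ x~u ⟩ [ _ ]) pre+1≡i (suc j) dx v~x with dist-predecessor dx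
    ... | y , y~x , dy =
      u≁v (upper-neighbours-adjacent claw-free dy
             (subst (Dist G s u) i≡2+j du) (subst (Dist G s v) i≡2+j dv)
             (adj-sym y~x) x~u (adj-sym v~x) u≢v)
      where
      i≡2+j : i ≡ suc (suc j)
      i≡2+j = ≤-antisym (dist-step dx (adj-sym v~x) dv) (begin
        suc (suc j)      ≤⟨ s≤s (proj₂ dx pre) ⟩
        suc (len G pre)  ≡⟨ +-comm 1 (len G pre) ⟩
        len G pre + 1    ≡⟨ pre+1≡i ⟩
        i                ∎)

    on-split : ∀ {x} → Σ (Walk G s x) (λ pre → Σ (Walk G x u) λ suf →
                          len G pre + len G suf ≡ len G p) → ¬ Adj v x
    on-split (pre , suf , pre+suf≡p) with dist-exists pre
    ... | d , dx = near-end pre suf (trans pre+suf≡p p≡i) d dx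

  -- In a claw-free graph every layer i ≠ 1 of an admissible vertex s is a
  -- clique: otherwise two non-adjacent vertices u, v of the layer give
  -- (u, s, v) ∈ B_D(G).
  layer-clique : ClawFree G → ∀ s → Admissible G s → ∀ i → i ≢ 1 → LayerClique G s i
  layer-clique claw-free s admissible zero _ u v du dv u≢v =
    ⊥-elim (u≢v (trans (dist-zero du) (sym (dist-zero dv))))
  layer-clique claw-free s admissible (suc zero) i≢1 = ⊥-elim (i≢1 refl)
  layer-clique claw-free s admissible (suc (suc _)) i≢1 u v du dv u≢v with adj-dec u v
  ... | yes u~v = u~v
  ... | no u≁v with dist⇒shortest du | dist⇒shortest dv
  ...   | p , p≡i , p-shortest | q , q≡i , q-shortest =
    ⊥-elim (admissible u v
      ( dist-positive⇒≢ du , u≢v , (dist-positive⇒≢ dv ∘ sym)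
      , (reverse p , shortest⇒chordless (reverse p) (shortest-reverse p p-shortest)
                   , avoids-reverse p (shortest-path-avoids claw-free i≢1 du dv u≢v u≁v p p≡i))
      , (q , shortest⇒chordless q q-shortest
           , shortest-path-avoids claw-free i≢1 dv du (u≢v ∘ sym) (u≁v ∘ adj-sym) q q≡i)))

  module Levels (connected : Connected G) (s : V G) where

    level : V G → ℕ
    level x = proj₁ (dist-exists (connected s x))

    level-dist : ∀ x → Dist G s x (level x)
    level-dist x = proj₂ (dist-exists (connected s x))

    level-step : ∀ {a b} → Adj a b → level b ≤ suc (level a)
    level-step e = dist-step (level-dist _) e (level-dist _)

    dominating-pair : ∀ t k → (∀ i → i ≢ 1 → LayerClique G s i) →
                      (∀ w d → Dist G s w d → d ≤ k) → Dist G s t k →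
                      DominatingPair G s t
    dominating-pair t k cliques bounded dt P _ w with level w ≟ℕ 1
    ... | yes lw≡1 with dist-predecessor (subst (Dist G s w) lw≡1 (level-dist w))
    ...   | y , y~w , dy =
      inj₂ (lose (start-∈ P) (adj-sym (subst (λ y → Adj y w) (dist-zero dy) y~w)))
    dominating-pair t k cliques bounded dt P _ w | no lw≢1
      with crossing level level-step P ls≤lw lw≤lt
      where
      ls≤lw : level s ≤ level w
      ls≤lw = ≤-trans (proj₂ (level-dist s) [ s ]) z≤n
      lw≤lt : level w ≤ level t
      lw≤lt = subst (level w ≤_) (dist-unique dt (level-dist t))
                    (bounded w (level w) (level-dist w))
    ... | x , x∈P , lx≡lw with x ≟ w
    ...   | yes refl = inj₁ x∈P
    ...   | no x≢w = inj₂ (lose x∈P (cliques (level w) lw≢1 w x (level-dist w)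
                             (subst (Dist G s x) lx≡lw (level-dist x)) (x≢w ∘ sym)))

lemma3 : ∀ {n : ℕ} (G : Graph n) → Connected G → ClawFree G → ATFree G →
    ∀ (s : V G) (k : ℕ) (t : V G) → Admissible G s → IsEccentricity G s k →
    Dist G s t k →
    (∀ (i : ℕ) → i ≢ 1 → i ≤ k → LayerClique G s i) × DominatingPair G s t
lemma3 G connected claw-free _ s k t admissible (bounded , _) dt =
  (λ i i≢1 _ → cliques i i≢1) ,
  Levels.dominating-pair G connected s t k cliques bounded dt
  where
  cliques : ∀ i → i ≢ 1 → LayerClique G s i
  cliques = layer-clique G claw-free s admissible
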